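{- Let $\mathbf{ILX}$ be any logic extending $\mathbf{IL}$, $\Gamma,\Delta$ $\mathbf{ILX}$-MCSs and $S$ a set of formulas. If $\Gamma\prec_S\Delta$, then $\Gamma\prec_{S\cup\Gamma^{\boxdot}_S}\Delta$.
   Context: Formulas: $\bot$, propositional variables, $\to$, $\Box$, binary $\rhd$; $\Diamond A:=\neg\Box\neg A$. $\mathbf{IL}$: classical tautologies, K, L: $\Box(\Box A\to A)\to\Box A$, J1: $\Box(A\to B)\to A\rhd B$, J2: $(A\rhd B)\wedge(B\rhd C)\to A\rhd C$, J3: $(A\rhd C)\wedge(B\rhd C)\to A\vee B\rhd C$, J4: $A\rhd B\to(\Diamond A\to\Diamond B)$, J5: $\Diamond A\rhd A$; rules modus ponens and necessitation. An $\mathbf{ILX}$-MCS is a maximal $\mathbf{ILX}$-consistent set. $\Gamma\prec_S\Delta$ iff for every formula $A$ and finite $S'\subseteq S$, $\neg A\rhd\bigvee_{\sigma\in S'}\neg\sigma\in\Gamma$ implies $A,\Box A\in\Delta$ (empty disjunction is $\bot$). $\Gamma^{\boxdot}_S=\{A,\Box A:\neg A\rhd\bigvee_{\sigma\in S'}\neg\sigma\in\Gamma$ for some finite $S'\subseteq S\}$. -}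

module Defs where

open import Data.Nat using (ℕ)
open import Data.Bool using (Bool; true; false; _∧_; not; _∨_)
open import Data.List using (List; []; _∷_; map)
open import Data.List.Relation.Unary.All using (All)
open import Data.Product using (Σ; _×_; ∃)
open import Data.Sum using (_⊎_)
open import Data.Empty using (⊥)
open import Relation.Binary.PropositionalEquality using (_≡_)
open import Relation.Nullary using (¬_)

infixr 5 _⇒_
infix 6 _▷_
data Fm : Set where
  fal  : Fm
  var  : ℕ → Fm
  _⇒_  : Fm → Fm → Fm
  □_   : Fm → Fm
  _▷_  : Fm → Fm → Fm

~_ : Fm → Fm
~ A = A ⇒ fal

_∨'_ : Fm → Fm → Fm
A ∨' B = (~ A) ⇒ B

_∧'_ : Fm → Fm → Fm
A ∧' B = ~ (A ⇒ ~ B)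

◇_ : Fm → Fm
◇ A = ~ (□ (~ A))

-- Classical tautologies: true under every Boolean valuation in which
-- formulas whose main connective is not ⊥ or → are treated as atoms.
⟦_⟧ : Fm → (Fm → Bool) → Bool
⟦ fal ⟧ v = false
⟦ A ⇒ B ⟧ v = not (⟦ A ⟧ v) ∨ ⟦ B ⟧ v
⟦ var n ⟧ v = v (var n)
⟦ □ A ⟧ v = v (□ A)
⟦ A ▷ B ⟧ v = v (A ▷ B)

Tautology : Fm → Set
Tautology A = (v : Fm → Bool) → ⟦ A ⟧ v ≡ true

data ILAxiom : Fm → Set where
  axK  : ∀ A B → ILAxiom (□ (A ⇒ B) ⇒ (□ A ⇒ □ B))
  axL  : ∀ A → ILAxiom (□ (□ A ⇒ A) ⇒ □ A)
  axJ1 : ∀ A B → ILAxiom (□ (A ⇒ B) ⇒ (A ▷ B))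
  axJ2 : ∀ A B C → ILAxiom (((A ▷ B) ∧' (B ▷ C)) ⇒ (A ▷ C))
  axJ3 : ∀ A B C → ILAxiom (((A ▷ C) ∧' (B ▷ C)) ⇒ ((A ∨' B) ▷ C))
  axJ4 : ∀ A B → ILAxiom ((A ▷ B) ⇒ ((◇ A) ⇒ (◇ B)))
  axJ5 : ∀ A → ILAxiom ((◇ A) ▷ A)

record ExtendsIL (L : Fm → Set) : Set where
  field
    taut : ∀ {A} → Tautology A → L A
    ax   : ∀ {A} → ILAxiom A → L A
    mp   : ∀ {A B} → L (A ⇒ B) → L A → L B
    nec  : ∀ {A} → L A → L (□ A)

FSet : Set₁
FSet = Fm → Set

_∪_ : FSet → FSet → FSet
(X ∪ Y) A = X A ⊎ Y A

impAll : List Fm → Fm → Fm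
impAll [] B = B
impAll (γ ∷ γs) B = γ ⇒ impAll γs B

Consistent : (Fm → Set) → FSet → Set
Consistent L Γ = ¬ (Σ (List Fm) λ γs → All Γ γs × L (impAll γs fal))

MCS : (Fm → Set) → FSet → Set
MCS L Γ = Consistent L Γ × (∀ A → Consistent L (Γ ∪ (λ B → B ≡ A)) → Γ A)

⋁ : List Fm → Fm
⋁ [] = fal
⋁ (A ∷ As) = A ∨' ⋁ As

Prec : FSet → FSet → FSet → Set
Prec S Γ Δ = ∀ A (S' : List Fm) → All S S' →
  Γ ((~ A) ▷ ⋁ (map ~_ S')) → Δ A × Δ (□ A)

BoxDot : FSet → FSet → FSet
BoxDot Γ S B = Σ Fm λ A → Σ (List Fm) λ S' → All S S' ×
  Γ ((~ A) ▷ ⋁ (map ~_ S')) × (B ≡ A ⊎ B ≡ □ A)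

module Submission where

-- Every element σ of Γ^⊡_S is A or □A for some A with
-- ¬A ▷ ⋁¬S_σ ∈ Γ (S_σ ⊆ S finite); since ¬□A ▷ ◇¬A ▷ ¬A (J1, J5), in both
-- cases ¬σ ▷ ⋁¬S_σ ∈ Γ.  Joining these with J3 and J2, every finite
-- S' ⊆ S ∪ Γ^⊡_S has a finite T ⊆ S with ⋁¬S' ▷ ⋁¬T ∈ Γ.  So a premise
-- ¬A ▷ ⋁¬S' ∈ Γ of ≺_{S ∪ Γ^⊡_S} yields, by J2, the premise ¬A ▷ ⋁¬T ∈ Γ
-- of ≺_S, and the hypothesis Γ ≺_S Δ gives A, □A ∈ Δ.

open import Defs
open import Data.Bool using (Bool; true; false; not; _∨_)
open import Data.Empty using (⊥-elim)
open import Data.List using (List; []; _∷_; map; _++_)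
open import Data.List.Properties using (map-++)
open import Data.List.Relation.Unary.All using (All; []; _∷_)
open import Data.List.Relation.Unary.All.Properties using (++⁺; ++⁻)
open import Data.Product using (Σ; _×_; _,_; proj₁; proj₂)
open import Data.Sum using (_⊎_; inj₁; inj₂; [_,_]′)
open import Relation.Binary.PropositionalEquality using (_≡_; refl; sym; trans; subst)
open import Relation.Nullary using (¬_)

-- Truth of A under a valuation v.  Wrapping it in a record makes the formula
-- recoverable from the type, so the rules below infer their arguments.
record _⊨_ (v : Fm → Bool) (A : Fm) : Set where
  constructor holds
  field truth : ⟦ A ⟧ v ≡ true
open _⊨_

Valid : Fm → Set
Valid A = ∀ v → v ⊨ A

⊭fal : ∀ {v} → ¬ (v ⊨ fal)
⊭fal (holds ())

⇒-intro : ∀ {v A B} → (v ⊨ A → v ⊨ B) → v ⊨ (A ⇒ B)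
⇒-intro {v} {A} {B} f = holds (implication (⟦ A ⟧ v) (⟦ B ⟧ v) (λ a → truth (f (holds a))))
  where
  implication : ∀ a b → (a ≡ true → b ≡ true) → not a ∨ b ≡ true
  implication true  b h = h refl
  implication false b h = refl

⇒-elim : ∀ {v A B} → v ⊨ (A ⇒ B) → v ⊨ A → v ⊨ B
⇒-elim {v} {A} {B} (holds h) (holds a) = holds (modusPonens (⟦ A ⟧ v) (⟦ B ⟧ v) h a)
  where
  modusPonens : ∀ a b → not a ∨ b ≡ true → a ≡ true → b ≡ true
  modusPonens true b h _ = h

excludedMiddle : ∀ v A → v ⊨ A ⊎ v ⊨ (~ A)
excludedMiddle v A with ⟦ A ⟧ v in eq
... | true  = inj₁ (holds eq)
... | false = inj₂ (⇒-intro λ a → holds (trans (sym eq) (truth a)))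

∧-intro : ∀ {v A B} → v ⊨ A → v ⊨ B → v ⊨ (A ∧' B)
∧-intro a b = ⇒-intro λ a⇒¬b → ⇒-elim (⇒-elim a⇒¬b a) b

impAll-intro : ∀ {v B} γs → (All (v ⊨_) γs → v ⊨ B) → v ⊨ impAll γs B
impAll-intro []       h = h []
impAll-intro (γ ∷ γs) h = ⇒-intro λ g → impAll-intro γs λ gs → h (g ∷ gs)

impAll-elim : ∀ {v B} γs → v ⊨ impAll γs B → All (v ⊨_) γs → v ⊨ B
impAll-elim []       h []       = h
impAll-elim (γ ∷ γs) h (g ∷ gs) = impAll-elim γs (⇒-elim h g) gs

⋁-++ˡ : ∀ {v} xs ys → v ⊨ ⋁ xs → v ⊨ ⋁ (xs ++ ys)
⋁-++ˡ []       ys h = ⊥-elim (⊭fal h)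
⋁-++ˡ (x ∷ xs) ys h = ⇒-intro λ ¬x → ⋁-++ˡ xs ys (⇒-elim h ¬x)

⋁-++ʳ : ∀ {v} xs ys → v ⊨ ⋁ ys → v ⊨ ⋁ (xs ++ ys)
⋁-++ʳ []       ys h = h
⋁-++ʳ (x ∷ xs) ys h = ⇒-intro λ _ → ⋁-++ʳ xs ys h

removeAdded : ∀ {Γ : FSet} {Z ds} → All (Γ ∪ (λ B → B ≡ Z)) ds →
  Σ (List Fm) λ γs → All Γ γs × (∀ v → All (v ⊨_) γs → v ⊨ Z → All (v ⊨_) ds)
removeAdded [] = [] , [] , λ _ _ _ → []
removeAdded (inj₁ d∈Γ ∷ ds∈) with removeAdded ds∈
... | γs , γs∈Γ , restore = _ ∷ γs , d∈Γ ∷ γs∈Γ , λ { v (d ∷ gs) z → d ∷ restore v gs z }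
removeAdded (inj₂ refl ∷ ds∈) with removeAdded ds∈
... | γs , γs∈Γ , restore = γs , γs∈Γ , λ v gs z → z ∷ restore v gs z

module InMCS (L : Fm → Set) (logic : ExtendsIL L) (Γ : FSet) (mcs : MCS L Γ) where
  open ExtendsIL logic

  tautology : ∀ {A} → Valid A → L A
  tautology h = taut λ v → truth (h v)

  -- Otherwise a refutation of Γ ∪ {Z} would combine
  -- with the derivation of Z into a refutation of Γ.
  closed : ∀ {γs Z} → All Γ γs → L (impAll γs Z) → Γ Z
  closed {γs} {Z} γs∈Γ ⊢Z = proj₂ mcs Z λ (ds , ds∈ , ⊢¬ds) →
    let (δs , δs∈Γ , restore) = removeAdded ds∈
    in proj₁ mcs (γs ++ δs , ++⁺ γs∈Γ δs∈Γ , mp (mp (tautology (cut δs restore)) ⊢Z) ⊢¬ds)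
    where
    cut : ∀ {ds} δs → (∀ v → All (v ⊨_) δs → v ⊨ Z → All (v ⊨_) ds) →
      Valid (impAll γs Z ⇒ (impAll ds fal ⇒ impAll (γs ++ δs) fal))
    cut {ds} δs restore = λ v → ⇒-intro λ γs⇒Z → ⇒-intro λ ¬ds →
      impAll-intro (γs ++ δs) λ all → let (gs , hs) = ++⁻ γs all in
        impAll-elim ds ¬ds (restore v hs (impAll-elim γs γs⇒Z gs))

  theorem∈ : ∀ {A} → L A → Γ A
  theorem∈ = closed []

  rule₂ : ∀ {A B C} → L ((A ∧' B) ⇒ C) → Γ A → Γ B → Γ C
  rule₂ {A} {B} {C} ⊢rule a b = closed (a ∷ b ∷ []) (mp (tautology curry) ⊢rule)
    where
    curry : Valid (((A ∧' B) ⇒ C) ⇒ (A ⇒ (B ⇒ C)))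
    curry = λ v → ⇒-intro λ h → ⇒-intro λ a → ⇒-intro λ b → ⇒-elim h (∧-intro a b)

  ▷-from-⇒ : ∀ {A B} → L (A ⇒ B) → Γ (A ▷ B)
  ▷-from-⇒ {A} {B} ⊢A⇒B = theorem∈ (mp (ax (axJ1 A B)) (nec ⊢A⇒B))

  ▷-trans : ∀ {A B C} → Γ (A ▷ B) → Γ (B ▷ C) → Γ (A ▷ C)
  ▷-trans = rule₂ (ax (axJ2 _ _ _))

  ▷-join : ∀ {A B C} → Γ (A ▷ C) → Γ (B ▷ C) → Γ ((A ∨' B) ▷ C)
  ▷-join = rule₂ (ax (axJ3 _ _ _))

  ▷-refl : ∀ {A} → Γ (A ▷ A)
  ▷-refl = ▷-from-⇒ (tautology (λ v → ⇒-intro λ a → a))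

  -- ¬□A ▷ ¬A: by K, ¬□A implies ◇¬A = ¬□¬¬A, and ◇¬A ▷ ¬A is J5.
  ¬□▷¬ : ∀ A → Γ ((~ (□ A)) ▷ (~ A))
  ¬□▷¬ A = ▷-trans (▷-from-⇒ ¬□⇒◇¬) (theorem∈ (ax (axJ5 (~ A))))
    where
    doubleNegation : Valid ((~ (~ A)) ⇒ A)
    doubleNegation = λ v → ⇒-intro λ ¬¬a →
      [ (λ a → a) , (λ ¬a → ⊥-elim (⊭fal (⇒-elim ¬¬a ¬a))) ]′ (excludedMiddle v A)

    contraposition : ∀ P Q → Valid ((P ⇒ Q) ⇒ ((~ Q) ⇒ (~ P)))
    contraposition P Q = λ v → ⇒-intro λ p⇒q → ⇒-intro λ ¬q → ⇒-intro λ p →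
      ⇒-elim ¬q (⇒-elim p⇒q p)

    □¬¬⇒□ : L (□ (~ (~ A)) ⇒ □ A)
    □¬¬⇒□ = mp (ax (axK _ _)) (nec (tautology doubleNegation))

    ¬□⇒◇¬ : L ((~ (□ A)) ⇒ (◇ (~ A)))
    ¬□⇒◇¬ = mp (tautology (contraposition _ _)) □¬¬⇒□

  ▷-⋁-++ : ∀ {A B} xs ys → Γ (A ▷ ⋁ xs) → Γ (B ▷ ⋁ ys) → Γ ((A ∨' B) ▷ ⋁ (xs ++ ys))
  ▷-⋁-++ xs ys A▷xs B▷ys =
    ▷-join (▷-trans A▷xs (▷-from-⇒ (tautology (λ v → ⇒-intro (⋁-++ˡ xs ys)))))
           (▷-trans B▷ys (▷-from-⇒ (tautology (λ v → ⇒-intro (⋁-++ʳ xs ys)))))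

  -- Γ ⊢ ¬σ ▷ ⋁¬T for a finite T ⊆ S: the shape to which ≺_S applies.
  ReducesTo : FSet → Fm → Set
  ReducesTo S B = Σ (List Fm) λ T → All S T × Γ (B ▷ ⋁ (map ~_ T))

  reduceOne : ∀ {S σ} → (S ∪ BoxDot Γ S) σ → ReducesTo S (~ σ)
  reduceOne {σ = σ} (inj₁ σ∈S) =
    σ ∷ [] , σ∈S ∷ [] , ▷-from-⇒ (tautology (λ v → ⇒-intro λ ¬σ → ⇒-intro λ ¬¬σ → ⇒-elim ¬¬σ ¬σ))
  reduceOne (inj₂ (A , T , T⊆S , ¬A▷T , inj₁ refl)) = T , T⊆S , ¬A▷T
  reduceOne (inj₂ (A , T , T⊆S , ¬A▷T , inj₂ refl)) = T , T⊆S , ▷-trans (¬□▷¬ A) ¬A▷T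

  reduce : ∀ {S} S' → All (S ∪ BoxDot Γ S) S' → ReducesTo S (⋁ (map ~_ S'))
  reduce []       []           = [] , [] , ▷-refl
  reduce (σ ∷ S') (σ∈ ∷ S'⊆) with reduceOne σ∈ | reduce S' S'⊆
  ... | Tσ , Tσ⊆S , σ▷Tσ | T , T⊆S , S'▷T =
    Tσ ++ T , ++⁺ Tσ⊆S T⊆S ,
    subst (λ ds → Γ (⋁ (map ~_ (σ ∷ S')) ▷ ⋁ ds)) (sym (map-++ ~_ Tσ T))
      (▷-⋁-++ (map ~_ Tσ) (map ~_ T) σ▷Tσ S'▷T)

lemma4p4 : (L : Fm → Set) → ExtendsIL L →
    (Γ Δ : FSet) → MCS L Γ → MCS L Δ → (S : FSet) →
    Prec S Γ Δ → Prec (S ∪ BoxDot Γ S) Γ Δ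
lemma4p4 L logic Γ Δ Γ-mcs _ S Γ≺Δ A S' S'⊆ ¬A▷S' with InMCS.reduce L logic Γ Γ-mcs S' S'⊆
... | T , T⊆S , S'▷T = Γ≺Δ A T T⊆S (InMCS.▷-trans L logic Γ Γ-mcs ¬A▷S' S'▷T)
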